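{- For each $n\ge0$, the map $\mu\mapsto\mu'$ described in the context is a bijection from the set of symmetric Dyck paths with a total of $n$ arches and half-arches onto the set of Dyck paths of semilength $n+1$.
   Context: A symmetric Dyck path (symmetric non-crossing perfect matching) is a word in $\{u,d\}$ in which every prefix has at least as many $u$'s as $d$'s. Each $d$ is matched to an earlier $u$ by parenthesis matching; such a pair is an arch. The unmatched $u$'s are half-arches. A Dyck path of semilength $m$ is a word with $m$ letters $u$ and $m$ letters $d$ in which every prefix has at least as many $u$'s as $d$'s. The map $\mu\mapsto\mu'$ is defined as follows: 1. replace each $u$ of $\mu$ that is a half-arch by the two letters $du$; 2. keep the letters of arches unchanged; 3. prepend a $u$ and append a $d$ to the resulting word. -}

module Defs where

open import Data.Nat using (ℕ; zero; suc; _≤_)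
open import Data.Bool using (Bool; true; false; if_then_else_)
open import Data.List using (List; []; _∷_; _++_)
open import Data.Product using (_×_)
open import Relation.Binary.PropositionalEquality using (_≡_)

data Step : Set where
  u d : Step

count : Step → List Step → ℕ
count x [] = 0
count u (u ∷ w) = suc (count u w)
count u (d ∷ w) = count u w
count d (u ∷ w) = count d w
count d (d ∷ w) = suc (count d w)

PrefixOK : List Step → Set
PrefixOK w = ∀ (p s : List Step) → p ++ s ≡ w → count d p ≤ count u p

IsSymDyck : List Step → Set
IsSymDyck = PrefixOK

IsDyck : ℕ → List Step → Set
IsDyck m w = PrefixOK w × count u w ≡ m × count d w ≡ m

-- Parenthesis matching: a u followed by the suffix w is matched (to a later d)
-- iff `closes 0 w` is true; k counts the u's of w still open.
closes : ℕ → List Step → Bool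
closes k [] = false
closes k (u ∷ w) = closes (suc k) w
closes zero (d ∷ w) = true
closes (suc k) (d ∷ w) = closes k w

-- the u at the head of (u ∷ w) is a half-arch iff it is not matched
isHalfArch : List Step → Bool
isHalfArch w = if closes zero w then false else true

expand : List Step → List Step
expand [] = []
expand (d ∷ w) = d ∷ expand w
expand (u ∷ w) = (if isHalfArch w then d ∷ u ∷ [] else u ∷ []) ++ expand w

prime : List Step → List Step
prime w = u ∷ (expand w ++ d ∷ [])

-- total number of arches and half-arches = number of u's (each u is the
-- opening of an arch or a half-arch, and each arch contains exactly one u)
arches+halfArches : List Step → ℕ
arches+halfArches = count u

{-# OPTIONS --safe #-}
-- Let depth w be how far w descends below its starting height.  A u followed
-- by w is a half-arch exactly when depth w = 0, and an induction on w then
-- shows that expand w, started at height 1 + depth w, never goes below 0 and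
-- ends at height 1.  A symmetric Dyck path has depth 0, so prime μ is a Dyck
-- path.  Conversely, reading expand μ from height 1, the d's that come down to
-- height 0 are exactly those inserted in front of half-arches; deleting them
-- inverts expand on every path from height 1 to height 1, which gives
-- injectivity and surjectivity.
module Submission where

open import Defs
open import Data.Nat using (ℕ; zero; suc; _+_; _≤_; z≤n; s≤s; pred; _<ᵇ_)
open import Data.Nat.Properties
  using (+-suc; +-identityʳ; suc-injective; +-cancelʳ-≡; +-cancelʳ-≤; n≤0⇒n≡0;
         ≤-trans; ≤-reflexive; +-monoˡ-≤; pred-mono-≤; m≤n+m∸n; module ≤-Reasoning)
open import Data.List using (List; []; _∷_; _++_; _∷ʳ_; _∷ʳ′_; initLast)
open import Data.List.Properties using (∷-injectiveʳ; ∷ʳ-injectiveˡ)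
open import Data.Product using (_×_; Σ; ∃; ∃₂; _,_)
open import Relation.Binary.PropositionalEquality
  using (_≡_; refl; sym; trans; cong; subst; module ≡-Reasoning)

private variable
  i j k : ℕ
  w x y E μ ν : List Step

count-++ : ∀ s x y → count s (x ++ y) ≡ count s x + count s y
count-++ s [] y = refl
count-++ u (u ∷ x) y = cong suc (count-++ u x y)
count-++ u (d ∷ x) y = count-++ u x y
count-++ d (u ∷ x) y = count-++ d x y
count-++ d (d ∷ x) y = cong suc (count-++ d x y)

count-u-∷ʳd : ∀ x → count u (x ∷ʳ d) ≡ count u x
count-u-∷ʳd x = trans (count-++ u x (d ∷ [])) (+-identityʳ (count u x))

-- depth w is the maximum of count d p ∸ count u p over the prefixes p of w.
depth : List Step → ℕ
depth [] = 0
depth (u ∷ w) = pred (depth w)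
depth (d ∷ w) = suc (depth w)

prefix-count-bound : ∀ p s → count d p ≤ depth (p ++ s) + count u p
prefix-count-bound [] s = z≤n
prefix-count-bound (d ∷ p) s = s≤s (prefix-count-bound p s)
prefix-count-bound (u ∷ p) s = begin
  count d p                         ≤⟨ prefix-count-bound p s ⟩
  δ + count u p                     ≤⟨ +-monoˡ-≤ (count u p) (m≤n+m∸n δ 1) ⟩
  suc (pred δ) + count u p          ≡⟨ sym (+-suc (pred δ) (count u p)) ⟩
  pred δ + suc (count u p)          ∎
  where
  open ≤-Reasoning
  δ = depth (p ++ s)

depth-attained : ∀ w → ∃₂ λ p s → p ++ s ≡ w × count d p ≡ depth w + count u p
depth-attained [] = [] , [] , refl , refl
depth-attained (d ∷ w) with depth-attained w
... | p , s , refl , e = d ∷ p , s , refl , cong suc e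
depth-attained (u ∷ w) with depth w | depth-attained w
... | zero  | _ = [] , u ∷ w , refl , refl
... | suc m | p , s , refl , e = u ∷ p , s , refl , trans e (sym (+-suc m (count u p)))

isSymDyck⇒depth≡0 : IsSymDyck w → depth w ≡ 0
isSymDyck⇒depth≡0 {w} ok with depth-attained w
... | p , s , eq , e = n≤0⇒n≡0 (+-cancelʳ-≤ (count u p) (depth w) 0
                                   (subst (_≤ count u p) e (ok p s eq)))

depth≡0⇒isSymDyck : depth w ≡ 0 → IsSymDyck w
depth≡0⇒isSymDyck eq p s refl =
  subst (λ m → count d p ≤ m + count u p) eq (prefix-count-bound p s)

data Path : ℕ → ℕ → List Step → Set where
  []   : Path k k []
  up   : Path (suc i) j w → Path i j (u ∷ w)
  down : Path i j w → Path (suc i) j (d ∷ w)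

Path-++ : Path i j x → Path j k y → Path i k (x ++ y)
Path-++ [] q = q
Path-++ (up p) q = up (Path-++ p q)
Path-++ (down p) q = down (Path-++ p q)

Path-++⁻ : ∀ x → Path i k (x ++ y) → ∃ λ j → Path i j x × Path j k y
Path-++⁻ [] p = _ , [] , p
Path-++⁻ (u ∷ x) (up p) with Path-++⁻ x p
... | j , px , py = j , up px , py
Path-++⁻ (d ∷ x) (down p) with Path-++⁻ x p
... | j , px , py = j , down px , py

Path-last-down : Path (suc i) 0 w → ∃ λ E → Path (suc i) 1 E × w ≡ E ∷ʳ d
Path-last-down {w = w} p with initLast w
Path-last-down () | []
Path-last-down p | E ∷ʳ′ s with Path-++⁻ E p
... | _ , pE , down [] = E , pE , refl

Path⇒depth≤ : Path i j w → depth w ≤ i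
Path⇒depth≤ [] = z≤n
Path⇒depth≤ (up p) = pred-mono-≤ (Path⇒depth≤ p)
Path⇒depth≤ (down p) = s≤s (Path⇒depth≤ p)

Path⇒counts : Path i j w → i + count u w ≡ j + count d w
Path⇒counts [] = refl
Path⇒counts {i} (up {w = w} p) = trans (+-suc i (count u w)) (Path⇒counts p)
Path⇒counts (down {j = j} {w = w} p) =
  trans (cong suc (Path⇒counts p)) (sym (+-suc j (count d w)))

depth≤⇒Path : ∀ w → depth w ≤ i → i + count u w ≡ j + count d w → Path i j w
depth≤⇒Path {i} {j} [] _ e with +-cancelʳ-≡ 0 i j e
... | refl = []
depth≤⇒Path {i} (u ∷ w) le e =
  up (depth≤⇒Path w (≤-trans (m≤n+m∸n (depth w) 1) (s≤s le))
                    (trans (sym (+-suc i (count u w))) e))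
depth≤⇒Path {suc i} {j} (d ∷ w) (s≤s le) e =
  down (depth≤⇒Path w le (suc-injective (trans e (+-suc j (count d w)))))

isDyck⇒Path : IsDyck k w → Path 0 0 w
isDyck⇒Path {w = w} (ok , cu , cd) =
  depth≤⇒Path w (≤-reflexive (isSymDyck⇒depth≡0 ok)) (trans cu (sym cd))

Path⇒isDyck : Path 0 0 w → IsDyck (count u w) w
Path⇒isDyck p =
  depth≡0⇒isSymDyck (n≤0⇒n≡0 (Path⇒depth≤ p)) , refl , sym (Path⇒counts p)

closes≡<ᵇdepth : ∀ k w → closes k w ≡ (k <ᵇ depth w)
closes≡<ᵇdepth k [] = refl
closes≡<ᵇdepth k (u ∷ w) = trans (closes≡<ᵇdepth (suc k) w) (suc<ᵇ≡<ᵇpred (depth w))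
  where
  suc<ᵇ≡<ᵇpred : ∀ n → (suc k <ᵇ n) ≡ (k <ᵇ pred n)
  suc<ᵇ≡<ᵇpred zero = refl
  suc<ᵇ≡<ᵇpred (suc n) = refl
closes≡<ᵇdepth zero (d ∷ w) = refl
closes≡<ᵇdepth (suc k) (d ∷ w) = closes≡<ᵇdepth k w

expand-halfArch : ∀ w → depth w ≡ 0 → expand (u ∷ w) ≡ d ∷ u ∷ expand w
expand-halfArch w eq rewrite closes≡<ᵇdepth 0 w | eq = refl

expand-arch : ∀ w → depth w ≡ suc k → expand (u ∷ w) ≡ u ∷ expand w
expand-arch w eq rewrite closes≡<ᵇdepth 0 w | eq = refl

count-u-expand : ∀ w → count u (expand w) ≡ count u w
count-u-expand [] = refl
count-u-expand (d ∷ w) = count-u-expand w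
count-u-expand (u ∷ w) with depth w in eq
... | zero  = trans (cong (count u) (expand-halfArch w eq)) (cong suc (count-u-expand w))
... | suc _ = trans (cong (count u) (expand-arch w eq)) (cong suc (count-u-expand w))

Path-expand : ∀ w → Path (suc (depth w)) 1 (expand w)
Path-expand [] = []
Path-expand (d ∷ w) = down (Path-expand w)
Path-expand (u ∷ w) with depth w in eq | Path-expand w
... | zero  | p = subst (Path 1 1) (sym (expand-halfArch w eq)) (down (up p))
... | suc k | p = subst (Path (suc k) 1) (sym (expand-arch w eq)) (up p)

-- contract h E reads E from height h and deletes every d that comes down to
-- height 0; on paths the last clause is never reached.
contract : ℕ → List Step → List Step
contract h [] = []
contract h (u ∷ E) = u ∷ contract (suc h) E
contract (suc (suc h)) (d ∷ E) = d ∷ contract (suc h) E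
contract 1 (d ∷ E) = contract 0 E
contract 0 (d ∷ E) = []

contract-expand : ∀ w → contract (suc (depth w)) (expand w) ≡ w
contract-expand [] = refl
contract-expand (d ∷ w) = cong (d ∷_) (contract-expand w)
contract-expand (u ∷ w) with depth w in eq | contract-expand w
... | zero  | ih = trans (cong (contract 1) (expand-halfArch w eq)) (cong (u ∷_) ih)
... | suc k | ih = trans (cong (contract (suc k)) (expand-arch w eq)) (cong (u ∷_) ih)

depth-contract : Path (suc k) 1 E → depth (contract (suc k) E) ≡ k
depth-contract [] = refl
depth-contract (up p) = cong pred (depth-contract p)
depth-contract {suc k} (down p) = cong suc (depth-contract p)
depth-contract {zero} (down (up p)) = cong pred (depth-contract p)

expand-contract : Path (suc k) 1 E → expand (contract (suc k) E) ≡ E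
expand-contract [] = refl
expand-contract {k} (up {w = E} p) =
  trans (expand-arch (contract (suc (suc k)) E) (depth-contract p))
        (cong (u ∷_) (expand-contract p))
expand-contract {suc k} (down p) = cong (d ∷_) (expand-contract p)
expand-contract {zero} (down (up {w = E} p)) =
  trans (expand-halfArch (contract 1 E) (depth-contract p))
        (cong (λ E → d ∷ u ∷ E) (expand-contract p))

count-u-prime : ∀ μ → count u (prime μ) ≡ suc (count u μ)
count-u-prime μ = cong suc (trans (count-u-∷ʳd (expand μ)) (count-u-expand μ))

Path-prime : IsSymDyck μ → Path 0 0 (prime μ)
Path-prime {μ} ok = up (Path-++ Path-expandμ (down []))
  where
  Path-expandμ : Path 1 1 (expand μ)
  Path-expandμ = subst (λ k → Path (suc k) 1 (expand μ)) (isSymDyck⇒depth≡0 ok) (Path-expand μ)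

prime-isDyck : IsSymDyck μ → IsDyck (suc (count u μ)) (prime μ)
prime-isDyck {μ} ok =
  subst (λ m → IsDyck m (prime μ)) (count-u-prime μ) (Path⇒isDyck (Path-prime ok))

contract-expand-symDyck : IsSymDyck μ → contract 1 (expand μ) ≡ μ
contract-expand-symDyck {μ} ok =
  subst (λ k → contract (suc k) (expand μ) ≡ μ) (isSymDyck⇒depth≡0 ok) (contract-expand μ)

prime-injective : IsSymDyck μ → IsSymDyck ν → prime μ ≡ prime ν → μ ≡ ν
prime-injective {μ} {ν} okμ okν eq = begin
  μ                      ≡⟨ sym (contract-expand-symDyck okμ) ⟩
  contract 1 (expand μ)  ≡⟨ cong (contract 1) expandμ≡expandν ⟩
  contract 1 (expand ν)  ≡⟨ contract-expand-symDyck okν ⟩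
  ν                      ∎
  where
  open ≡-Reasoning
  expandμ≡expandν : expand μ ≡ expand ν
  expandμ≡expandν = ∷ʳ-injectiveˡ (expand μ) (expand ν) (∷-injectiveʳ eq)

prime-surjective : ∀ n w → IsDyck (suc n) w →
  Σ (List Step) (λ μ → IsSymDyck μ × count u μ ≡ n × prime μ ≡ w)
prime-surjective n w dyck@(_ , cu , _) with isDyck⇒Path dyck
prime-surjective n .[] (_ , () , _) | []
... | up p with Path-last-down p
...   | E , pE , refl = contract 1 E
                      , depth≡0⇒isSymDyck (depth-contract pE)
                      , count-u-contract
                      , cong (λ E′ → u ∷ E′ ∷ʳ d) (expand-contract pE)
  where
  count-u-contract : count u (contract 1 E) ≡ n
  count-u-contract = begin
    count u (contract 1 E)           ≡⟨ sym (count-u-expand (contract 1 E)) ⟩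
    count u (expand (contract 1 E))  ≡⟨ cong (count u) (expand-contract pE) ⟩
    count u E                        ≡⟨ sym (count-u-∷ʳd E) ⟩
    count u (E ∷ʳ d)                 ≡⟨ suc-injective cu ⟩
    n                                ∎
    where open ≡-Reasoning

lemma7p7 : (n : ℕ) →
    ((μ : List Step) → IsSymDyck μ → arches+halfArches μ ≡ n → IsDyck (suc n) (prime μ))
    × ((μ ν : List Step) → IsSymDyck μ → arches+halfArches μ ≡ n →
         IsSymDyck ν → arches+halfArches ν ≡ n → prime μ ≡ prime ν → μ ≡ ν)
    × ((w : List Step) → IsDyck (suc n) w →
         Σ (List Step) (λ μ → IsSymDyck μ × arches+halfArches μ ≡ n × prime μ ≡ w))
lemma7p7 n =
    (λ μ ok → λ { refl → prime-isDyck ok })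
  , (λ μ ν okμ _ okν _ → prime-injective okμ okν)
  , prime-surjective n
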